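{- Let $M$ and $N$ be matroids having neither loops nor coloops. Let $\{P_1,\ldots,P_d\}$ be a partition of the set of all chains (including the empty chain) in $\mathcal{Z}^{\circ}(M)$, and let $\{Q_1,\ldots,Q_d\}$ be a partition of the set of all chains in $\mathcal{Z}^{\circ}(N)$. If $\mathrm{comp}(\mathrm{fl}_M(P_i))=\mathrm{comp}(\mathrm{fl}_N(Q_i))$ for each $i\in[d]$, then $\mathcal{G}(M)=\mathcal{G}(N)$.
   Context: All matroids are finite. A cyclic flat is a flat that is a (possibly empty) union of circuits; for a matroid with neither loops nor coloops, $\emptyset$ and $E(M)$ are cyclic flats, and $\mathcal{Z}^{\circ}(M)$ is the set of nonempty proper cyclic flats, ordered by inclusion. A flag of a rank-$k$ matroid $M$ is a sequence $(X_0,X_1,\ldots,X_k)$ with $X_i$ a rank-$i$ flat and $X_i\subsetneq X_{i+1}$; its composition is $(|X_0|,|X_1-X_0|,\ldots,|X_k-X_{k-1}|)$. The reduced cyclic chain of a flag of a matroid with neither loops nor coloops is obtained by removing from each $X_i$ the coloops of $M|X_i$ (giving a chain of cyclic flats) and then discarding $\emptyset$ and $E(M)$. For a chain $C$ in $\mathcal{Z}^{\circ}(M)$, $\mathrm{fl}_M(C)$ is the set of flags whose reduced cyclic chain is $C$; for a set $T$ of chains, $\mathrm{fl}_M(T)=\bigcup_{C\in T}\mathrm{fl}_M(C)$; for a set $S$ of flags, $\mathrm{comp}(S)$ is the multiset of their compositions. The $\mathcal{G}$-invariant: for a permutation $e_1,\ldots,e_n$ of $E(M)$ the rank sequence is $r_1\cdots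 r_n$ with $r_i=r(\{e_1,\ldots,e_i\})-r(\{e_1,\ldots,e_{i-1}\})$, and $\mathcal{G}(M)=\sum_\pi[\underline r(\pi)]$, a formal sum of basis symbols indexed by $0/1$-sequences, over a field of characteristic zero. -}

module Defs where

open import Data.Bool using (Bool; true; false; _∧_; _∨_; not; T)
open import Data.Nat using (ℕ; zero; suc; _≤_; _<_; _+_; _∸_; _≡ᵇ_; _<ᵇ_)
import Data.Nat as ℕ
open import Data.Fin using (Fin)
import Data.Fin as Fin
open import Data.Fin.Subset using (Subset; ⁅_⁆; _∈_; _∉_; _⊆_; _⊂_; _∪_; _∩_; ∁; _─_; _-_; ∣_∣; Nonempty)
  renaming (⊥ to ∅; ⊤ to Eset)
open import Data.Vec using (Vec; []; _∷_; lookup; tabulate; toList)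
import Data.Vec.Properties as VecP
open import Data.List using (List; []; _∷_; length; filter; map; concatMap; deduplicate; allFin)
import Data.List as List
import Data.List.Properties as ListP
open import Data.List.Relation.Unary.Unique.DecPropositional using (unique?)
open import Data.List.Relation.Unary.Any using (Any)
open import Data.List.Relation.Unary.All using (All)
open import Data.List.Relation.Unary.Linked using (Linked)
open import Data.Product using (Σ; ∃; _×_; _,_)
open import Relation.Nullary using (¬_; Dec; does)
open import Relation.Nullary.Decidable using (⌊_⌋)
open import Relation.Binary.PropositionalEquality using (_≡_; _≢_)

allᵇ : {A : Set} → (A → Bool) → List A → Bool
allᵇ p []       = true
allᵇ p (x ∷ xs) = p x ∧ allᵇ p xs

record Matroid (n : ℕ) : Set where
  field
    rank      : Subset n → ℕ
    rank-card : ∀ X → rank X ≤ ∣ X ∣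
    rank-mono : ∀ X Y → X ⊆ Y → rank X ≤ rank Y
    rank-sub  : ∀ X Y → rank (X ∪ Y) + rank (X ∩ Y) ≤ rank X + rank Y

open Matroid public

module _ {n : ℕ} (M : Matroid n) where

  rk : ℕ
  rk = rank M Eset

  IsLoop : Fin n → Set
  IsLoop e = rank M ⁅ e ⁆ ≡ 0

  IsColoop : Fin n → Set
  IsColoop e = rank M (Eset - e) < rk

  NoLoopsNoColoops : Set
  NoLoopsNoColoops = (∀ e → ¬ IsLoop e) × (∀ e → ¬ IsColoop e)

  IsCircuit : Subset n → Set
  IsCircuit C = (rank M C < ∣ C ∣) × (∀ e → e ∈ C → rank M (C - e) ≡ ∣ C - e ∣)

  IsFlat : Subset n → Set
  IsFlat X = ∀ e → e ∉ X → rank M X < rank M (X ∪ ⁅ e ⁆)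

  IsCyclicFlat : Subset n → Set
  IsCyclicFlat X = IsFlat X × (∀ e → e ∈ X → ∃ λ C → IsCircuit C × e ∈ C × C ⊆ X)

  -- Chains in Z°(M): strictly increasing lists of nonempty proper cyclic flats
  -- (a chain, as a set of cyclic flats, is represented by its elements listed in
  -- increasing order; the empty list is the empty chain).
  IsChain : List (Subset n) → Set
  IsChain C = All (λ X → IsCyclicFlat X × X ≢ ∅ × X ≢ Eset) C × Linked _⊂_ C

  _≟ₛ_ : (X Y : Subset n) → Dec (X ≡ Y)
  _≟ₛ_ = VecP.≡-dec Data.Bool._≟_
    where import Data.Bool

  memb : Fin n → Subset n → Bool
  memb e X = lookup X e

  isFlatᵇ : Subset n → Bool
  isFlatᵇ X = allᵇ (λ e → memb e X ∨ (rank M X <ᵇ rank M (X ∪ ⁅ e ⁆))) (allFin n)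

  subsetᵇ : Subset n → Subset n → Bool
  subsetᵇ X Y = allᵇ (λ e → not (memb e X) ∨ memb e Y) (allFin n)

  strictSubᵇ : Subset n → Subset n → Bool
  strictSubᵇ X Y = subsetᵇ X Y ∧ not (does (X ≟ₛ Y))

  isFlagFromᵇ : ℕ → {m : ℕ} → Vec (Subset n) m → Bool
  isFlagFromᵇ i []           = true
  isFlagFromᵇ i (X ∷ [])     = isFlatᵇ X ∧ (rank M X ≡ᵇ i)
  isFlagFromᵇ i (X ∷ Y ∷ Xs) = isFlatᵇ X ∧ (rank M X ≡ᵇ i) ∧ strictSubᵇ X Y
                                 ∧ isFlagFromᵇ (suc i) (Y ∷ Xs)

  isFlagᵇ : Vec (Subset n) (suc rk) → Bool
  isFlagᵇ = isFlagFromᵇ 0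

  compFrom : Subset n → List (Subset n) → List ℕ
  compFrom P []       = []
  compFrom P (X ∷ Xs) = ∣ X ─ P ∣ ∷ compFrom X Xs

  comp : {m : ℕ} → Vec (Subset n) m → List ℕ
  comp F = compFrom ∅ (toList F)

  -- Remove from X the coloops of M|X (e ∈ X with r(X - e) < r(X)).
  cycPart : Subset n → Subset n
  cycPart X = tabulate λ e → memb e X ∧ (rank M (X - e) ≡ᵇ rank M X)

  redChain : {m : ℕ} → Vec (Subset n) m → List (Subset n)
  redChain F =
    filter (λ X → ¬? (X ≟ₛ ∅)) (filter (λ X → ¬? (X ≟ₛ Eset))
      (deduplicate _≟ₛ_ (map cycPart (toList F))))
    where open import Relation.Nullary using (¬?)

vecsOf : {A : Set} → List A → (m : ℕ) → List (Vec A m)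
vecsOf xs zero    = [] ∷ []
vecsOf xs (suc m) = concatMap (λ x → map (x ∷_) (vecsOf xs m)) xs

allSubsets : (n : ℕ) → List (Subset n)
allSubsets n = vecsOf (true ∷ false ∷ []) n

count : {A : Set} → (A → Bool) → List A → ℕ
count p xs = length (filter (λ x → Data.Bool._≟_ (p x) true) xs)
  where import Data.Bool

_≟ℓ_ : (s t : List ℕ) → Dec (s ≡ t)
_≟ℓ_ = ListP.≡-dec ℕ._≟_

-- Flags with reduced cyclic chain in block i of a labelling p of chains,
-- counted with composition c: the multiplicity of c in comp(fl_M(P_i)).

compMult : {n d : ℕ} (M : Matroid n) → (List (Subset n) → Fin d) → Fin d → List ℕ → ℕ
compMult {n} M p i c =
  count (λ F → isFlagᵇ M F ∧ does (p (redChain M F) Fin.≟ i) ∧ does (comp M F ≟ℓ c))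
        (vecsOf (allSubsets n) (suc (rk M)))

-- The G-invariant: coefficient of [s] in G(M) is the number of permutations
-- e_1..e_n of E(M) whose rank sequence is s.

rankSeqFrom : {n : ℕ} (M : Matroid n) → Subset n → List (Fin n) → List ℕ
rankSeqFrom M S []       = []
rankSeqFrom M S (e ∷ es) = (rank M (S ∪ ⁅ e ⁆) ∸ rank M S) ∷ rankSeqFrom M (S ∪ ⁅ e ⁆) es

rankSeq : {n : ℕ} (M : Matroid n) → List (Fin n) → List ℕ
rankSeq M π = rankSeqFrom M ∅ π

isPermᵇ : {n : ℕ} → Vec (Fin n) n → Bool
isPermᵇ π = does (unique? Fin._≟_ (toList π))

Gcoeff : {n : ℕ} (M : Matroid n) → List ℕ → ℕ
Gcoeff {n} M s =
  count (λ π → isPermᵇ π ∧ does (rankSeq M (toList π) ≟ℓ s)) (vecsOf (allFin n) n)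

-- A permutation e₁ … eₙ of E induces a flag: its i-th flat is the closure of the shortest prefix of
-- rank i. Reading the permutation from left to right, an increment 0 adds an element of the
-- current flat and an increment 1 adds an element of the next flat of the flag, and at each step the
-- number of admissible choices depends only on the sizes of the steps of the flag. Hence the
-- coefficient of [s] in G(M) is a sum over all flags F of a weight of (comp F, s), so G(M) is
-- determined by the multiset of compositions of flags. Summing the hypothesis over the d blocks
-- shows that M and N have the same such multiset; loops, coloops and the chain partition play no
-- further role.

module Submission where

open import Defs
open import Data.Bool using (Bool; true; false; _∧_; _∨_; not; if_then_else_)
import Data.Bool as B
import Data.Bool.Properties as BP
open import Data.Empty using (⊥-elim)
open import Data.Fin using (Fin)
import Data.Fin as Fin
open import Data.Fin.Subset using (Subset; ⁅_⁆; _∪_; _∩_; _─_; _⊆_; ∣_∣) renaming (⊥ to ∅; ⊤ to Eset)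
open import Data.Fin.Subset.Properties using (∣⊥∣≡0; ∣⊤∣≡n; ∣⁅x⁆∣≡1; p─⊤≡⊥; p─⊥≡p)
open import Data.List using (List; []; _∷_; _++_; map; concatMap; filter; allFin)
import Data.List as List
open import Data.List.Properties using (map-tabulate)
open import Data.List.Membership.Propositional using () renaming (_∈_ to _∈ₗ_)
open import Data.List.Membership.Propositional.Properties using (∈-allFin)
open import Data.List.Relation.Unary.All using (All; []; _∷_)
open import Data.List.Relation.Unary.AllPairs using ([]; _∷_)
open import Data.List.Relation.Unary.Any using (here; there)
import Data.List.Relation.Unary.Unique.DecPropositional as Unique
import Data.List.Relation.Unary.All as All
open import Data.Nat using (ℕ; zero; suc; _+_; _*_; _∸_; _≤_; _<_; _≡ᵇ_; _<ᵇ_)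
import Data.Nat as ℕ
open import Data.Nat.Properties
open import Data.Product using (∃; _×_; _,_; proj₁; proj₂)
open import Data.Vec using (Vec; []; _∷_; lookup; tabulate; toList)
import Data.Vec.Properties as VecP
open import Function using (_∘_; Equivalence)
open import Relation.Binary.Definitions using (DecidableEquality)
open import Relation.Binary.PropositionalEquality
open import Relation.Nullary using (yes; no; does)
open import Relation.Nullary.Decidable using (dec-true; dec-false; T?)

open import Algebra.Properties.CommutativeSemigroup +-commutativeSemigroup
  using () renaming (interchange to +-interchange; x∙yz≈y∙xz to +-left-comm)
open import Algebra.Properties.CommutativeSemigroup *-commutativeSemigroup
  using () renaming (interchange to *-interchange; x∙yz≈y∙xz to *-left-comm)

-- Finite sums

⟦_⟧ : Bool → ℕ
⟦ true ⟧  = 1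
⟦ false ⟧ = 0

false≢true : false ≢ true
false≢true ()

⟦∧⟧ : ∀ a b → ⟦ a ∧ b ⟧ ≡ ⟦ a ⟧ * ⟦ b ⟧
⟦∧⟧ true  b = sym (+-identityʳ ⟦ b ⟧)
⟦∧⟧ false b = refl

private
  variable
    A B : Set

∑ : List A → (A → ℕ) → ℕ
∑ []       f = 0
∑ (x ∷ xs) f = f x + ∑ xs f

syntax ∑ xs (λ x → f) = ∑[ x ← xs ] f

∑-cong : (xs : List A) {f g : A → ℕ} → (∀ x → f x ≡ g x) → ∑ xs f ≡ ∑ xs g
∑-cong []       f≗g = refl
∑-cong (x ∷ xs) f≗g = cong₂ _+_ (f≗g x) (∑-cong xs f≗g)

∑-zero : (xs : List A) → ∑[ _ ← xs ] 0 ≡ 0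
∑-zero []       = refl
∑-zero (x ∷ xs) = ∑-zero xs

∑-++ : (xs ys : List A) (f : A → ℕ) → ∑ (xs ++ ys) f ≡ ∑ xs f + ∑ ys f
∑-++ []       ys f = refl
∑-++ (x ∷ xs) ys f = trans (cong (f x +_) (∑-++ xs ys f)) (sym (+-assoc (f x) _ _))

∑-distrib-+ : (xs : List A) (f g : A → ℕ) → ∑[ x ← xs ] (f x + g x) ≡ ∑ xs f + ∑ xs g
∑-distrib-+ []       f g = refl
∑-distrib-+ (x ∷ xs) f g =
  trans (cong (f x + g x +_) (∑-distrib-+ xs f g)) (+-interchange (f x) (g x) _ _)

∑-*ˡ : (xs : List A) (c : ℕ) (f : A → ℕ) → ∑[ x ← xs ] (c * f x) ≡ c * ∑ xs f
∑-*ˡ []       c f = sym (*-zeroʳ c)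
∑-*ˡ (x ∷ xs) c f = trans (cong (c * f x +_) (∑-*ˡ xs c f)) (sym (*-distribˡ-+ c (f x) _))

∑-*ʳ : (xs : List A) (c : ℕ) (f : A → ℕ) → ∑[ x ← xs ] (f x * c) ≡ ∑ xs f * c
∑-*ʳ xs c f = trans (∑-cong xs (λ x → *-comm (f x) c)) (trans (∑-*ˡ xs c f) (*-comm c _))

∑-comm : (xs : List A) (ys : List B) (f : A → B → ℕ) →
  ∑[ x ← xs ] ∑[ y ← ys ] f x y ≡ ∑[ y ← ys ] ∑[ x ← xs ] f x y
∑-comm []       ys f = sym (∑-zero ys)
∑-comm (x ∷ xs) ys f =
  trans (cong (∑ ys (f x) +_) (∑-comm xs ys f)) (sym (∑-distrib-+ ys (f x) _))

∑-map : (g : A → B) (xs : List A) (f : B → ℕ) → ∑ (map g xs) f ≡ ∑[ x ← xs ] f (g x)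
∑-map g []       f = refl
∑-map g (x ∷ xs) f = cong (f (g x) +_) (∑-map g xs f)

∑-concatMap : (g : A → List B) (xs : List A) (f : B → ℕ) →
  ∑ (concatMap g xs) f ≡ ∑[ x ← xs ] ∑ (g x) f
∑-concatMap g []       f = refl
∑-concatMap g (x ∷ xs) f =
  trans (∑-++ (g x) (concatMap g xs) f) (cong (∑ (g x) f +_) (∑-concatMap g xs f))

∑-zero-inv : (xs : List A) (f : A → ℕ) → ∑ xs f ≡ 0 → ∀ {x} → x ∈ₗ xs → f x ≡ 0
∑-zero-inv (y ∷ xs) f eq (here refl) = m+n≡0⇒m≡0 (f y) eq
∑-zero-inv (y ∷ xs) f eq (there x∈) = ∑-zero-inv xs f (m+n≡0⇒n≡0 (f y) eq) x∈

count≡∑ : (p : A → Bool) (xs : List A) → count p xs ≡ ∑[ x ← xs ] ⟦ p x ⟧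
count≡∑ p []       = refl
count≡∑ p (x ∷ xs) with p x
... | true  = cong suc (count≡∑ p xs)
... | false = count≡∑ p xs

∑-map-filter : (P : A → Bool) (φ : A → B) (xs : List A) (h : B → ℕ) →
  ∑ (map φ (filter (T? ∘ P) xs)) h ≡ ∑[ x ← xs ] (⟦ P x ⟧ * h (φ x))
∑-map-filter P φ []       h = refl
∑-map-filter P φ (x ∷ xs) h with P x
... | true  = cong₂ _+_ (sym (*-identityˡ (h (φ x)))) (∑-map-filter P φ xs h)
... | false = ∑-map-filter P φ xs h

∑-vecsOf-suc : (xs : List A) (m : ℕ) (f : Vec A (suc m) → ℕ) →
  ∑ (vecsOf xs (suc m)) f ≡ ∑[ x ← xs ] ∑[ v ← vecsOf xs m ] f (x ∷ v)
∑-vecsOf-suc xs m f = trans (∑-concatMap _ xs f) (∑-cong xs (λ x → ∑-map (x ∷_) (vecsOf xs m) f))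

module _ (_≟_ : DecidableEquality A) where

  ≟-refl : ∀ x → does (x ≟ x) ≡ true
  ≟-refl x = dec-true (x ≟ x) refl

  ≟-sym : ∀ x y → does (x ≟ y) ≡ does (y ≟ x)
  ≟-sym x y with x ≟ y
  ... | yes refl = sym (≟-refl x)
  ... | no x≢y   = sym (dec-false (y ≟ x) (x≢y ∘ sym))

  multiplicity : A → List A → ℕ
  multiplicity y xs = ∑[ x ← xs ] ⟦ does (x ≟ y) ⟧

  Enumerates : List A → Set
  Enumerates xs = ∀ y → multiplicity y xs ≡ 1

  ∑-δ : (xs : List A) → Enumerates xs →
    ∀ y (h : A → ℕ) → ∑[ x ← xs ] (⟦ does (x ≟ y) ⟧ * h x) ≡ h y
  ∑-δ xs enum y h = begin
    ∑[ x ← xs ] (⟦ does (x ≟ y) ⟧ * h x) ≡⟨ ∑-cong xs δh≗δhy ⟩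
    ∑[ x ← xs ] (⟦ does (x ≟ y) ⟧ * h y) ≡⟨ ∑-*ʳ xs (h y) _ ⟩
    ∑[ x ← xs ] ⟦ does (x ≟ y) ⟧ * h y   ≡⟨ cong (_* h y) (enum y) ⟩
    1 * h y                              ≡⟨ *-identityˡ (h y) ⟩
    h y                                  ∎
    where
    open ≡-Reasoning
    δh≗δhy : ∀ x → ⟦ does (x ≟ y) ⟧ * h x ≡ ⟦ does (x ≟ y) ⟧ * h y
    δh≗δhy x with x ≟ y
    ... | yes refl = refl
    ... | no _     = refl

  ∑-fibres : (ys : List A) → Enumerates ys → (xs : List B) (φ : B → A) (w : B → ℕ) (h : A → ℕ) →
    ∑[ x ← xs ] (w x * h (φ x)) ≡ ∑[ y ← ys ] (h y * ∑[ x ← xs ] (w x * ⟦ does (φ x ≟ y) ⟧))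
  ∑-fibres ys enum xs φ w h = begin
    ∑[ x ← xs ] (w x * h (φ x))
      ≡⟨ ∑-cong xs (λ x → cong (w x *_) (sym (∑-δ ys enum (φ x) h))) ⟩
    ∑[ x ← xs ] (w x * ∑[ y ← ys ] (⟦ does (y ≟ φ x) ⟧ * h y))
      ≡⟨ ∑-cong xs (λ x → sym (∑-*ˡ ys (w x) _)) ⟩
    ∑[ x ← xs ] ∑[ y ← ys ] (w x * (⟦ does (y ≟ φ x) ⟧ * h y))
      ≡⟨ ∑-comm xs ys _ ⟩
    ∑[ y ← ys ] ∑[ x ← xs ] (w x * (⟦ does (y ≟ φ x) ⟧ * h y))
      ≡⟨ ∑-cong ys (λ y → ∑-cong xs (λ x → regroup (w x) (h y) (≟-sym y (φ x)))) ⟩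
    ∑[ y ← ys ] ∑[ x ← xs ] (h y * (w x * ⟦ does (φ x ≟ y) ⟧))
      ≡⟨ ∑-cong ys (λ y → ∑-*ˡ xs (h y) _) ⟩
    ∑[ y ← ys ] (h y * ∑[ x ← xs ] (w x * ⟦ does (φ x ≟ y) ⟧)) ∎
    where
    open ≡-Reasoning
    regroup : ∀ a c {b b′} → b ≡ b′ → a * (⟦ b ⟧ * c) ≡ c * (a * ⟦ b′ ⟧)
    regroup a c {b} refl = trans (sym (*-assoc a ⟦ b ⟧ c)) (*-comm (a * ⟦ b ⟧) c)

  remove : A → List A → List A
  remove x []       = []
  remove x (y ∷ ys) = if does (y ≟ x) then ys else y ∷ remove x ys

  ∑-remove : ∀ x ys (h : A → ℕ) → multiplicity x ys ≢ 0 → ∑ ys h ≡ h x + ∑ (remove x ys) h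
  ∑-remove x []       h x∉ = ⊥-elim (x∉ refl)
  ∑-remove x (y ∷ ys) h x∈ with y ≟ x
  ... | yes refl = refl
  ... | no _     = trans (cong (h y +_) (∑-remove x ys h x∈)) (+-left-comm (h y) (h x) _)

  ∑-cong-multiplicity : ∀ xs ys (h : A → ℕ) →
    (∀ z → multiplicity z xs ≡ multiplicity z ys) → ∑ xs h ≡ ∑ ys h
  ∑-cong-multiplicity []       []       h same = refl
  ∑-cong-multiplicity []       (y ∷ ys) h same =
    ⊥-elim (0≢1+n (trans (same y) (cong (_+ multiplicity y ys) (cong ⟦_⟧ (≟-refl y)))))
  ∑-cong-multiplicity (x ∷ xs) ys       h same = begin
    h x + ∑ xs h                  ≡⟨ cong (h x +_) (∑-cong-multiplicity xs (remove x ys) h same′) ⟩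
    h x + ∑ (remove x ys) h       ≡⟨ sym (∑-remove x ys h x∈ys) ⟩
    ∑ ys h                        ∎
    where
    open ≡-Reasoning
    x∈xs : multiplicity x (x ∷ xs) ≡ suc (multiplicity x xs)
    x∈xs = cong (_+ multiplicity x xs) (cong ⟦_⟧ (≟-refl x))
    x∈ys : multiplicity x ys ≢ 0
    x∈ys eq = 1+n≢0 (trans (sym x∈xs) (trans (same x) eq))
    same′ : ∀ z → multiplicity z xs ≡ multiplicity z (remove x ys)
    same′ z = +-cancelˡ-≡ ⟦ does (x ≟ z) ⟧ _ _
      (trans (same z) (∑-remove x ys (λ y → ⟦ does (y ≟ z) ⟧) x∈ys))

enumerates-vecsOf : (_≟_ : DecidableEquality A) {xs : List A} → Enumerates _≟_ xs →
  ∀ m → Enumerates (VecP.≡-dec _≟_) (vecsOf xs m)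
enumerates-vecsOf _≟_ enum zero    [] = refl
enumerates-vecsOf {A} _≟_ {xs} enum (suc m) (y ∷ w) = begin
  ∑[ v ← vecsOf xs (suc m) ] ⟦ does (v ≟ᵛ (y ∷ w)) ⟧
    ≡⟨ ∑-vecsOf-suc xs m _ ⟩
  ∑[ x ← xs ] ∑[ v ← vecsOf xs m ] ⟦ does (x ≟ y) ∧ does (v ≟ᵛ w) ⟧
    ≡⟨ ∑-cong xs (λ x → ∑-cong (vecsOf xs m) (λ v → ⟦∧⟧ (does (x ≟ y)) _)) ⟩
  ∑[ x ← xs ] ∑[ v ← vecsOf xs m ] (⟦ does (x ≟ y) ⟧ * ⟦ does (v ≟ᵛ w) ⟧)
    ≡⟨ ∑-cong xs (λ x → ∑-*ˡ (vecsOf xs m) ⟦ does (x ≟ y) ⟧ _) ⟩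
  ∑[ x ← xs ] (⟦ does (x ≟ y) ⟧ * ∑[ v ← vecsOf xs m ] ⟦ does (v ≟ᵛ w) ⟧)
    ≡⟨ ∑-cong xs (λ x → cong (⟦ does (x ≟ y) ⟧ *_) (enumerates-vecsOf _≟_ enum m w)) ⟩
  ∑[ x ← xs ] (⟦ does (x ≟ y) ⟧ * 1)
    ≡⟨ ∑-cong xs (λ x → *-identityʳ _) ⟩
  ∑[ x ← xs ] ⟦ does (x ≟ y) ⟧
    ≡⟨ enum y ⟩
  1 ∎
  where
  open ≡-Reasoning
  _≟ᵛ_ : ∀ {k} → DecidableEquality (Vec A k)
  _≟ᵛ_ = VecP.≡-dec _≟_

∑-allFin-suc : ∀ n (h : Fin (suc n) → ℕ) →
  ∑ (allFin (suc n)) h ≡ h Fin.zero + ∑[ i ← allFin n ] h (Fin.suc i)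
∑-allFin-suc n h = cong (h Fin.zero +_)
  (trans (cong (λ is → ∑ is h) (sym (map-tabulate (λ i → i) Fin.suc))) (∑-map Fin.suc (allFin n) h))

enumerates-allFin : ∀ n → Enumerates Fin._≟_ (allFin n)
enumerates-allFin (suc n) y = trans (∑-allFin-suc n (λ x → ⟦ does (x Fin.≟ y) ⟧)) (lemma y)
  where
  lemma : ∀ y → ⟦ does (Fin.zero Fin.≟ y) ⟧ + ∑[ x ← allFin n ] ⟦ does (Fin.suc x Fin.≟ y) ⟧ ≡ 1
  lemma Fin.zero    = cong suc (∑-zero (allFin n))
  lemma (Fin.suc y) = enumerates-allFin n y

_≟ˢ_ : ∀ {n} → DecidableEquality (Subset n)
_≟ˢ_ = VecP.≡-dec B._≟_

enumerates-allSubsets : ∀ n → Enumerates _≟ˢ_ (allSubsets n)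
enumerates-allSubsets = enumerates-vecsOf B._≟_ λ { true → refl ; false → refl }

-- Subsets of Fin n

lookup-─ : ∀ {n} (p q : Subset n) (x : Fin n) → lookup (p ─ q) x ≡ lookup p x ∧ not (lookup q x)
lookup-─ (a ∷ p) (true  ∷ q) Fin.zero    = sym (BP.∧-zeroʳ a)
lookup-─ (a ∷ p) (false ∷ q) Fin.zero    = sym (BP.∧-identityʳ a)
lookup-─ (a ∷ p) (b ∷ q)     (Fin.suc x) = lookup-─ p q x

lookup-⁅⁆ : ∀ {n} (e x : Fin n) → lookup ⁅ e ⁆ x ≡ does (e Fin.≟ x)
lookup-⁅⁆ Fin.zero    Fin.zero    = refl
lookup-⁅⁆ Fin.zero    (Fin.suc x) = VecP.lookup-replicate x false
lookup-⁅⁆ (Fin.suc e) Fin.zero    = refl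
lookup-⁅⁆ (Fin.suc e) (Fin.suc x) = lookup-⁅⁆ e x

∣∣≡∑ : ∀ {n} (p : Subset n) → ∣ p ∣ ≡ ∑[ x ← allFin n ] ⟦ lookup p x ⟧
∣∣≡∑ []          = refl
∣∣≡∑ (true ∷ p)  = trans (cong suc (∣∣≡∑ p)) (sym (∑-allFin-suc _ (λ x → ⟦ lookup (true ∷ p) x ⟧)))
∣∣≡∑ (false ∷ p) = trans (∣∣≡∑ p) (sym (∑-allFin-suc _ (λ x → ⟦ lookup (false ∷ p) x ⟧)))

module _ {n : ℕ} where

  lookup-∪ : (p q : Subset n) (x : Fin n) → lookup (p ∪ q) x ≡ lookup p x ∨ lookup q x
  lookup-∪ p q x = VecP.lookup-zipWith _∨_ x p q

  lookup-∩ : (p q : Subset n) (x : Fin n) → lookup (p ∩ q) x ≡ lookup p x ∧ lookup q x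
  lookup-∩ p q x = VecP.lookup-zipWith _∧_ x p q

  lookup-∅ : (x : Fin n) → lookup ∅ x ≡ false
  lookup-∅ x = VecP.lookup-replicate x false

  lookup-⊤ : (x : Fin n) → lookup Eset x ≡ true
  lookup-⊤ x = VecP.lookup-replicate x true

  ≡-by-lookup : (p q : Subset n) → (∀ x → lookup p x ≡ lookup q x) → p ≡ q
  ≡-by-lookup p q same = trans (sym (VecP.tabulate∘lookup p))
    (trans (VecP.tabulate-cong same) (VecP.tabulate∘lookup q))

  ∣─∣≡∑ : (p q : Subset n) → ∣ p ─ q ∣ ≡ ∑[ x ← allFin n ] ⟦ lookup p x ∧ not (lookup q x) ⟧
  ∣─∣≡∑ p q = trans (∣∣≡∑ (p ─ q)) (∑-cong (allFin n) (λ x → cong ⟦_⟧ (lookup-─ p q x)))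

  _⊑_ : Subset n → Subset n → Set
  p ⊑ q = ∀ x → lookup p x ≡ true → lookup q x ≡ true

  ⊑⇒⊆ : {p q : Subset n} → p ⊑ q → p ⊆ q
  ⊑⇒⊆ {p} {q} p⊑q {x} x∈p = VecP.lookup⇒[]= x q (p⊑q x (VecP.[]=⇒lookup x∈p))

  ∅⊑ : (p : Subset n) → ∅ ⊑ p
  ∅⊑ p x x∈∅ = ⊥-elim (false≢true (trans (sym (lookup-∅ x)) x∈∅))

  ⊑⊤ : (p : Subset n) → p ⊑ Eset
  ⊑⊤ p x _ = lookup-⊤ x

  p⊑p∪q : (p q : Subset n) → p ⊑ (p ∪ q)
  p⊑p∪q p q x x∈p rewrite lookup-∪ p q x | x∈p = refl

  x∈p∪⁅x⁆ : (p : Subset n) (x : Fin n) → lookup (p ∪ ⁅ x ⁆) x ≡ true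
  x∈p∪⁅x⁆ p x rewrite lookup-∪ p ⁅ x ⁆ x | lookup-⁅⁆ x x | ≟-refl Fin._≟_ x = BP.∨-zeroʳ _

  p∪⁅x⁆⊑q : {p q : Subset n} {x : Fin n} → p ⊑ q → lookup q x ≡ true → (p ∪ ⁅ x ⁆) ⊑ q
  p∪⁅x⁆⊑q {p} {q} {x} p⊑q x∈q y y∈ rewrite lookup-∪ p ⁅ x ⁆ y | lookup-⁅⁆ x y
    with lookup p y in y∈p | x Fin.≟ y
  ... | true  | _        = p⊑q y y∈p
  ... | false | yes refl = x∈q

  ∪⁅⁆-mono : {p q : Subset n} (x : Fin n) → p ⊑ q → (p ∪ ⁅ x ⁆) ⊑ (q ∪ ⁅ x ⁆)
  ∪⁅⁆-mono {p} {q} x p⊑q =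
    p∪⁅x⁆⊑q {p = p} {q = q ∪ ⁅ x ⁆} (λ y y∈p → p⊑p∪q q ⁅ x ⁆ y (p⊑q y y∈p)) (x∈p∪⁅x⁆ q x)

  ∉-∪⁅⁆ : {p : Subset n} {x y : Fin n} → lookup (p ∪ ⁅ x ⁆) y ≡ false → lookup p y ≡ false
  ∉-∪⁅⁆ {p} {x} {y} y∉ with lookup p y in y∈p
  ... | false = refl
  ... | true  = ⊥-elim (false≢true (trans (sym y∉) (p⊑p∪q p ⁅ x ⁆ y y∈p)))

  ∉-∪⁅⁆-≢ : {p : Subset n} {x y : Fin n} → lookup (p ∪ ⁅ x ⁆) y ≡ false → x ≢ y
  ∉-∪⁅⁆-≢ {p} {x} y∉ refl = false≢true (trans (sym y∉) (x∈p∪⁅x⁆ p x))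

  ∉-∪⁅⁆⁺ : {p : Subset n} {x y : Fin n} → x ≢ y → lookup p y ≡ false →
    lookup (p ∪ ⁅ x ⁆) y ≡ false
  ∉-∪⁅⁆⁺ {p} {x} {y} x≢y y∉p rewrite lookup-∪ p ⁅ x ⁆ y | lookup-⁅⁆ x y | y∉p =
    dec-false (x Fin.≟ y) x≢y

  ∑-allFin-remove : (u v : Fin n → ℕ) (x : Fin n) → (∀ y → u y ≡ ⟦ does (y Fin.≟ x) ⟧ + v y) →
    ∑ (allFin n) u ≡ suc (∑ (allFin n) v)
  ∑-allFin-remove u v x u≡δ+v = trans (∑-cong (allFin n) u≡δ+v)
    (trans (∑-distrib-+ (allFin n) _ v) (cong (_+ ∑ (allFin n) v) (enumerates-allFin n x)))

  ∣─∣-remove : (p q : Subset n) (x : Fin n) → lookup p x ≡ true → lookup q x ≡ false →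
    ∣ p ─ q ∣ ≡ suc ∣ p ─ (q ∪ ⁅ x ⁆) ∣
  ∣─∣-remove p q x x∈p x∉q = trans (∣─∣≡∑ p q)
    (trans (∑-allFin-remove _ _ x split) (cong suc (sym (∣─∣≡∑ p (q ∪ ⁅ x ⁆)))))
    where
    split : ∀ y → ⟦ lookup p y ∧ not (lookup q y) ⟧
                ≡ ⟦ does (y Fin.≟ x) ⟧ + ⟦ lookup p y ∧ not (lookup (q ∪ ⁅ x ⁆) y) ⟧
    split y rewrite lookup-∪ q ⁅ x ⁆ y | lookup-⁅⁆ x y | ≟-sym Fin._≟_ x y with y Fin.≟ x
    ... | yes refl rewrite x∈p | x∉q = refl
    ... | no _     rewrite BP.∨-identityʳ (lookup q y) = refl

  ∣─∣-split : {p q r : Subset n} → p ⊑ q → q ⊑ r → ∣ r ─ p ∣ ≡ ∣ r ─ q ∣ + ∣ q ─ p ∣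
  ∣─∣-split {p} {q} {r} p⊑q q⊑r = begin
    ∣ r ─ p ∣                        ≡⟨ ∣─∣≡∑ r p ⟩
    ∑[ x ← allFin n ] ⟦ lookup r x ∧ not (lookup p x) ⟧
      ≡⟨ ∑-cong (allFin n) split ⟩
    ∑[ x ← allFin n ] (⟦ lookup r x ∧ not (lookup q x) ⟧ + ⟦ lookup q x ∧ not (lookup p x) ⟧)
      ≡⟨ ∑-distrib-+ (allFin n) _ _ ⟩
    _                                ≡⟨ sym (cong₂ _+_ (∣─∣≡∑ r q) (∣─∣≡∑ q p)) ⟩
    ∣ r ─ q ∣ + ∣ q ─ p ∣            ∎
    where
    open ≡-Reasoning
    split : ∀ x → ⟦ lookup r x ∧ not (lookup p x) ⟧
                ≡ ⟦ lookup r x ∧ not (lookup q x) ⟧ + ⟦ lookup q x ∧ not (lookup p x) ⟧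
    split x with lookup p x in x∈p | lookup q x in x∈q
    ... | true  | false = ⊥-elim (false≢true (trans (sym x∈q) (p⊑q x x∈p)))
    ... | true  | true  rewrite q⊑r x x∈q = refl
    ... | false | true  rewrite q⊑r x x∈q = refl
    ... | false | false = sym (+-identityʳ _)

≡ᵇ-≡ : ∀ {a b} → (a ≡ᵇ b) ≡ true → a ≡ b
≡ᵇ-≡ {a} {b} h = ≡ᵇ⇒≡ a b (Equivalence.from BP.T-≡ h)

≡-≡ᵇ : ∀ {a b} → a ≡ b → (a ≡ᵇ b) ≡ true
≡-≡ᵇ {a} {b} h = Equivalence.to BP.T-≡ (≡⇒≡ᵇ a b h)

≢-≡ᵇ : ∀ {a b} → a ≢ b → (a ≡ᵇ b) ≡ false
≢-≡ᵇ {a} {b} a≢b with a ≡ᵇ b in eq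
... | false = refl
... | true  = ⊥-elim (a≢b (≡ᵇ-≡ eq))

<ᵇ-< : ∀ {a b} → (a <ᵇ b) ≡ true → a < b
<ᵇ-< {a} {b} h = <ᵇ⇒< a b (Equivalence.from BP.T-≡ h)

<-<ᵇ : ∀ {a b} → a < b → (a <ᵇ b) ≡ true
<-<ᵇ h = Equivalence.to BP.T-≡ (<⇒<ᵇ h)

-- Rank, flats and closure

module Rank {n : ℕ} (M : Matroid n) where

  r : Subset n → ℕ
  r = rank M

  rank-⊑ : {p q : Subset n} → p ⊑ q → r p ≤ r q
  rank-⊑ p⊑q = rank-mono M _ _ (⊑⇒⊆ p⊑q)

  rank-∅ : r ∅ ≡ 0
  rank-∅ = n≤0⇒n≡0 (subst (r ∅ ≤_) (∣⊥∣≡0 n) (rank-card M ∅))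

  rank-∪⁅⁆≤ : (Z : Subset n) (e : Fin n) → r (Z ∪ ⁅ e ⁆) ≤ suc (r Z)
  rank-∪⁅⁆≤ Z e = begin
    r (Z ∪ ⁅ e ⁆)                   ≤⟨ m≤m+n _ _ ⟩
    r (Z ∪ ⁅ e ⁆) + r (Z ∩ ⁅ e ⁆)   ≤⟨ rank-sub M Z ⁅ e ⁆ ⟩
    r Z + r ⁅ e ⁆                   ≤⟨ +-monoʳ-≤ (r Z) r⁅e⁆≤1 ⟩
    r Z + 1                         ≡⟨ +-comm (r Z) 1 ⟩
    suc (r Z)                       ∎
    where
    open ≤-Reasoning
    r⁅e⁆≤1 : r ⁅ e ⁆ ≤ 1
    r⁅e⁆≤1 = subst (r ⁅ e ⁆ ≤_) (∣⁅x⁆∣≡1 e) (rank-card M ⁅ e ⁆)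

  marginal-antitone : {Z W : Subset n} (e : Fin n) → Z ⊑ W → r (W ∪ ⁅ e ⁆) + r Z ≤ r (Z ∪ ⁅ e ⁆) + r W
  marginal-antitone {Z} {W} e Z⊑W = begin
    r (W ∪ ⁅ e ⁆) + r Z                               ≡⟨ cong (λ X → r X + r Z) W∪e≡W∪Z∪e ⟩
    r (W ∪ (Z ∪ ⁅ e ⁆)) + r Z                         ≤⟨ +-monoʳ-≤ _ (rank-⊑ Z⊑W∩Z∪e) ⟩
    r (W ∪ (Z ∪ ⁅ e ⁆)) + r (W ∩ (Z ∪ ⁅ e ⁆))         ≤⟨ rank-sub M W (Z ∪ ⁅ e ⁆) ⟩
    r W + r (Z ∪ ⁅ e ⁆)                               ≡⟨ +-comm (r W) _ ⟩
    r (Z ∪ ⁅ e ⁆) + r W                               ∎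
    where
    open ≤-Reasoning
    W∪e≡W∪Z∪e : W ∪ ⁅ e ⁆ ≡ W ∪ (Z ∪ ⁅ e ⁆)
    W∪e≡W∪Z∪e = ≡-by-lookup _ _ absorb
      where
      absorb : ∀ x → lookup (W ∪ ⁅ e ⁆) x ≡ lookup (W ∪ (Z ∪ ⁅ e ⁆)) x
      absorb x rewrite lookup-∪ W ⁅ e ⁆ x | lookup-∪ W (Z ∪ ⁅ e ⁆) x | lookup-∪ Z ⁅ e ⁆ x
        with lookup Z x in x∈Z
      ... | false = refl
      ... | true  rewrite Z⊑W x x∈Z = refl
    Z⊑W∩Z∪e : Z ⊑ (W ∩ (Z ∪ ⁅ e ⁆))
    Z⊑W∩Z∪e x x∈Z rewrite lookup-∩ W (Z ∪ ⁅ e ⁆) x | lookup-∪ Z ⁅ e ⁆ x | Z⊑W x x∈Z | x∈Z = refl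

  Flat : Subset n → Set
  Flat X = ∀ e → lookup X e ≡ false → r X < r (X ∪ ⁅ e ⁆)

  rank-stays-inside : {Z Y : Subset n} → Z ⊑ Y → r Z ≡ r Y →
    ∀ {e} → lookup Y e ≡ true → r (Z ∪ ⁅ e ⁆) ≡ r Z
  rank-stays-inside {Z} {Y} Z⊑Y rZ≡rY {e} e∈Y = ≤-antisym
    (≤-trans (rank-⊑ (p∪⁅x⁆⊑q {p = Z} {q = Y} {x = e} Z⊑Y e∈Y)) (≤-reflexive (sym rZ≡rY)))
    (rank-⊑ (p⊑p∪q Z _))

  rank-jumps-outside : {Z Y : Subset n} → Flat Y → Z ⊑ Y → r Z ≡ r Y →
    ∀ {e} → lookup Y e ≡ false → r (Z ∪ ⁅ e ⁆) ≡ suc (r Z)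
  rank-jumps-outside {Z} {Y} flat Z⊑Y rZ≡rY {e} e∉Y =
    ≤-antisym (rank-∪⁅⁆≤ Z e) (+-cancelʳ-≤ (r Y) _ _ (begin
    suc (r Z) + r Y           ≡⟨ cong (λ k → suc k + r Y) rZ≡rY ⟩
    suc (r Y) + r Y           ≤⟨ +-monoˡ-≤ (r Y) (flat e e∉Y) ⟩
    r (Y ∪ ⁅ e ⁆) + r Y       ≡⟨ cong (r (Y ∪ ⁅ e ⁆) +_) (sym rZ≡rY) ⟩
    r (Y ∪ ⁅ e ⁆) + r Z       ≤⟨ marginal-antitone e Z⊑Y ⟩
    r (Z ∪ ⁅ e ⁆) + r Y       ∎))
    where open ≤-Reasoning

  closure : Subset n → Subset n
  closure Z = tabulate λ e → r (Z ∪ ⁅ e ⁆) ≡ᵇ r Z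

  lookup-closure : (Z : Subset n) (e : Fin n) → lookup (closure Z) e ≡ (r (Z ∪ ⁅ e ⁆) ≡ᵇ r Z)
  lookup-closure Z = VecP.lookup∘tabulate _

  ⊑-closure : (Z : Subset n) → Z ⊑ closure Z
  ⊑-closure Z e e∈Z rewrite lookup-closure Z e = ≡-≡ᵇ (rank-stays-inside (λ _ x → x) refl e∈Z)

  closure-unique : {Z Y : Subset n} → Flat Y → Z ⊑ Y → r Z ≡ r Y → closure Z ≡ Y
  closure-unique {Z} {Y} flat Z⊑Y rZ≡rY = ≡-by-lookup _ _ same
    where
    same : ∀ e → lookup (closure Z) e ≡ lookup Y e
    same e rewrite lookup-closure Z e with lookup Y e in e∈Y
    ... | true  = ≡-≡ᵇ (rank-stays-inside Z⊑Y rZ≡rY e∈Y)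
    ... | false = ≢-≡ᵇ λ eq → 1+n≢n (trans (sym (rank-jumps-outside flat Z⊑Y rZ≡rY e∈Y)) eq)

  addClosed : Subset n → List (Fin n) → Subset n
  addClosed Z []       = Z
  addClosed Z (e ∷ es) = if lookup (closure Z) e then addClosed Z es ∪ ⁅ e ⁆ else addClosed Z es

  addClosed-rank : (Z : Subset n) (es : List (Fin n)) → Z ⊑ addClosed Z es × r (addClosed Z es) ≡ r Z
  addClosed-rank Z []       = (λ _ x → x) , refl
  addClosed-rank Z (e ∷ es) with lookup (closure Z) e in e∈clZ | addClosed-rank Z es
  ... | false | IH             = IH
  ... | true  | Z⊑W , rW≡rZ    =
    (λ x x∈Z → p⊑p∪q W ⁅ e ⁆ x (Z⊑W x x∈Z)) ,
    ≤-antisym rank-≤ (≤-trans (≤-reflexive (sym rW≡rZ)) (rank-⊑ (p⊑p∪q W ⁅ e ⁆)))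
    where
    W = addClosed Z es
    rank-≤ : r (W ∪ ⁅ e ⁆) ≤ r Z
    rank-≤ = +-cancelʳ-≤ (r Z) _ _ (begin
      r (W ∪ ⁅ e ⁆) + r Z   ≤⟨ marginal-antitone e Z⊑W ⟩
      r (Z ∪ ⁅ e ⁆) + r W   ≡⟨ cong₂ _+_ (≡ᵇ-≡ (trans (sym (lookup-closure Z e)) e∈clZ)) rW≡rZ ⟩
      r Z + r Z             ∎)
      where open ≤-Reasoning

  ∈-addClosed : (Z : Subset n) (es : List (Fin n)) {e : Fin n} → e ∈ₗ es →
    lookup (closure Z) e ≡ true → lookup (addClosed Z es) e ≡ true
  ∈-addClosed Z (e ∷ es) (here refl) e∈clZ rewrite e∈clZ = x∈p∪⁅x⁆ (addClosed Z es) e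
  ∈-addClosed Z (e ∷ es) (there e′∈es) e′∈clZ with lookup (closure Z) e
  ... | true  = p⊑p∪q (addClosed Z es) ⁅ e ⁆ _ (∈-addClosed Z es e′∈es e′∈clZ)
  ... | false = ∈-addClosed Z es e′∈es e′∈clZ

  rank-closure : (Z : Subset n) → r (closure Z) ≡ r Z
  rank-closure Z = ≤-antisym
    (≤-trans (rank-⊑ (λ e → ∈-addClosed Z (allFin n) (∈-allFin e)))
             (≤-reflexive (proj₂ (addClosed-rank Z (allFin n)))))
    (rank-⊑ (⊑-closure Z))

  flat-closure : (Z : Subset n) → Flat (closure Z)
  flat-closure Z e e∉clZ = begin-strict
    r (closure Z)              ≡⟨ rank-closure Z ⟩
    r Z                        <⟨ ≤∧≢⇒< (rank-⊑ (p⊑p∪q Z ⁅ e ⁆)) (λ eq → rank-raised (sym eq)) ⟩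
    r (Z ∪ ⁅ e ⁆)              ≤⟨ rank-⊑ (∪⁅⁆-mono {p = Z} {q = closure Z} e (⊑-closure Z)) ⟩
    r (closure Z ∪ ⁅ e ⁆)      ∎
    where
    open ≤-Reasoning
    rank-raised : r (Z ∪ ⁅ e ⁆) ≢ r Z
    rank-raised eq = false≢true (trans (sym e∉clZ) (trans (lookup-closure Z e) (≡-≡ᵇ eq)))

  flat-of-full-rank : {X : Subset n} → Flat X → r X ≡ rk M → X ≡ Eset
  flat-of-full-rank {X} flat rX≡rk = ≡-by-lookup _ _ full
    where
    full : ∀ e → lookup X e ≡ lookup Eset e
    full e rewrite lookup-⊤ e with lookup X e in e∈X
    ... | true  = refl
    ... | false = ⊥-elim (<-irrefl refl (begin-strict
      r X             <⟨ flat e e∈X ⟩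
      r (X ∪ ⁅ e ⁆)   ≤⟨ rank-⊑ {X ∪ ⁅ e ⁆} (⊑⊤ (X ∪ ⁅ e ⁆)) ⟩
      r Eset          ≡⟨ sym rX≡rk ⟩
      r X             ∎))
      where open ≤-Reasoning

allᵇ-tabulate⁻ : ∀ {n} (p : A → Bool) (f : Fin n → A) →
  allᵇ p (List.tabulate f) ≡ true → ∀ i → p (f i) ≡ true
allᵇ-tabulate⁻ {n = suc n} p f all i with p (f Fin.zero) in p0
allᵇ-tabulate⁻ {n = suc n} p f all Fin.zero    | true = p0
allᵇ-tabulate⁻ {n = suc n} p f all (Fin.suc i) | true = allᵇ-tabulate⁻ p (f ∘ Fin.suc) all i

allᵇ-tabulate⁺ : ∀ {n} (p : A → Bool) (f : Fin n → A) →
  (∀ i → p (f i) ≡ true) → allᵇ p (List.tabulate f) ≡ true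
allᵇ-tabulate⁺ {n = zero}  p f all = refl
allᵇ-tabulate⁺ {n = suc n} p f all rewrite all Fin.zero = allᵇ-tabulate⁺ p (f ∘ Fin.suc) (all ∘ Fin.suc)

module Reflection {n : ℕ} (M : Matroid n) where
  open Rank M

  isFlatᵇ⇒Flat : (X : Subset n) → isFlatᵇ M X ≡ true → Flat X
  isFlatᵇ⇒Flat X flatᵇ e e∉X with allᵇ-tabulate⁻ _ (λ i → i) flatᵇ e
  ... | holds rewrite e∉X = <ᵇ-< holds

  Flat⇒isFlatᵇ : (X : Subset n) → Flat X → isFlatᵇ M X ≡ true
  Flat⇒isFlatᵇ X flat = allᵇ-tabulate⁺ _ (λ i → i) holds
    where
    holds : ∀ e → (lookup X e ∨ (r X <ᵇ r (X ∪ ⁅ e ⁆))) ≡ true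
    holds e with lookup X e in e∈X
    ... | true  = refl
    ... | false = <-<ᵇ (flat e e∈X)

  subsetᵇ⇒⊑ : (X Y : Subset n) → subsetᵇ M X Y ≡ true → X ⊑ Y
  subsetᵇ⇒⊑ X Y subᵇ e e∈X with allᵇ-tabulate⁻ _ (λ i → i) subᵇ e
  ... | holds rewrite e∈X = holds

  ⊑⇒subsetᵇ : (X Y : Subset n) → X ⊑ Y → subsetᵇ M X Y ≡ true
  ⊑⇒subsetᵇ X Y X⊑Y = allᵇ-tabulate⁺ _ (λ i → i) holds
    where
    holds : ∀ e → (not (lookup X e) ∨ lookup Y e) ≡ true
    holds e with lookup X e in e∈X
    ... | true  = X⊑Y e e∈X
    ... | false = refl

-- Counting permutations along flags

-- arrangements t c s counts the ways to list the remaining elements with rank increments s when t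
-- unlisted elements lie in the current flat and c lists the sizes of the later steps of the flag:
-- an increment 0 picks one of the t elements, an increment 1 picks one of the a elements of the next
-- step, after which a + t - 1 unlisted elements lie in the new flat.
arrangements : ℕ → List ℕ → List ℕ → ℕ
arrangements t       c       (0 ∷ s)           = t * arrangements (t ∸ 1) c s
arrangements t       c       (suc (suc _) ∷ s) = 0
arrangements t       []      (1 ∷ s)           = 0
arrangements t       (a ∷ c) (1 ∷ s)           = a * arrangements (a + t ∸ 1) c s
arrangements t       (a ∷ c) []                = 0
arrangements zero    []      []                = 1
arrangements (suc t) []      []                = 0

compositionWeight : List ℕ → List ℕ → ℕ
compositionWeight []      s = 0
compositionWeight (a ∷ c) s = arrangements a c s

arrangements-empty-flat : ∀ b s → arrangements 0 [] (b ∷ s) ≡ 0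
arrangements-empty-flat zero          s = refl
arrangements-empty-flat (suc zero)    s = refl
arrangements-empty-flat (suc (suc b)) s = refl

module Counting {n : ℕ} (M : Matroid n) where
  open Rank M
  open Reflection M

  distinctOutsideᵇ : Subset n → List (Fin n) → Bool
  distinctOutsideᵇ S []       = true
  distinctOutsideᵇ S (e ∷ es) = not (lookup S e) ∧ distinctOutsideᵇ (S ∪ ⁅ e ⁆) es

  orders : Subset n → ℕ → List ℕ → ℕ
  orders S k s = ∑[ π ← vecsOf (allFin n) k ]
    (⟦ distinctOutsideᵇ S (toList π) ⟧ * ⟦ does (rankSeqFrom M S (toList π) ≟ℓ s) ⟧)

  flagArrangements : Subset n → ℕ → ℕ → ℕ → List ℕ → ℕ
  flagArrangements X j m t s = ∑[ Ys ← vecsOf (allSubsets n) m ]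
    (⟦ isFlagFromᵇ M j (X ∷ Ys) ⟧ * arrangements t (compFrom M X (toList Ys)) s)

  gain : Subset n → Fin n → ℕ
  gain S e = r (S ∪ ⁅ e ⁆) ∸ r S

  orders-suc-[] : ∀ S k → orders S (suc k) [] ≡ 0
  orders-suc-[] S k = trans (∑-vecsOf-suc (allFin n) k _) (trans
    (∑-cong (allFin n) λ e → trans
      (∑-cong (vecsOf (allFin n) k) (λ π → *-zeroʳ ⟦ distinctOutsideᵇ S (e ∷ toList π) ⟧))
      (∑-zero (vecsOf (allFin n) k)))
    (∑-zero (allFin n)))

  orders-suc-∷ : ∀ S k b s → orders S (suc k) (b ∷ s)
    ≡ ∑[ e ← allFin n ] (⟦ not (lookup S e) ⟧ * (⟦ does (gain S e ℕ.≟ b) ⟧ * orders (S ∪ ⁅ e ⁆) k s))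
  orders-suc-∷ S k b s = trans (∑-vecsOf-suc (allFin n) k _) (∑-cong (allFin n) first-step)
    where
    first-step : ∀ e → ∑[ π ← vecsOf (allFin n) k ]
        (⟦ distinctOutsideᵇ S (e ∷ toList π) ⟧ * ⟦ does (rankSeqFrom M S (e ∷ toList π) ≟ℓ (b ∷ s)) ⟧)
      ≡ ⟦ not (lookup S e) ⟧ * (⟦ does (gain S e ℕ.≟ b) ⟧ * orders (S ∪ ⁅ e ⁆) k s)
    first-step e = begin
      ∑[ π ← vecsOf (allFin n) k ] (⟦ a ∧ d π ⟧ * ⟦ b′ ∧ q π ⟧)
        ≡⟨ ∑-cong (vecsOf (allFin n) k) (λ π → trans (cong₂ _*_ (⟦∧⟧ a (d π)) (⟦∧⟧ b′ (q π)))
                                                     (*-interchange ⟦ a ⟧ _ ⟦ b′ ⟧ _)) ⟩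
      ∑[ π ← vecsOf (allFin n) k ] ((⟦ a ⟧ * ⟦ b′ ⟧) * (⟦ d π ⟧ * ⟦ q π ⟧))
        ≡⟨ ∑-*ˡ (vecsOf (allFin n) k) (⟦ a ⟧ * ⟦ b′ ⟧) _ ⟩
      (⟦ a ⟧ * ⟦ b′ ⟧) * orders (S ∪ ⁅ e ⁆) k s
        ≡⟨ *-assoc ⟦ a ⟧ ⟦ b′ ⟧ _ ⟩
      ⟦ a ⟧ * (⟦ b′ ⟧ * orders (S ∪ ⁅ e ⁆) k s) ∎
      where
      open ≡-Reasoning
      a  = not (lookup S e)
      b′ = does (gain S e ℕ.≟ b)
      d : Vec (Fin n) k → Bool
      d π = distinctOutsideᵇ (S ∪ ⁅ e ⁆) (toList π)
      q : Vec (Fin n) k → Bool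
      q π = does (rankSeqFrom M (S ∪ ⁅ e ⁆) (toList π) ≟ℓ s)

  -- S is the set of elements listed so far and X, its closure, the flat of the flag reached so far.
  record Position (S X : Subset n) (j m : ℕ) : Set where
    field
      flat   : Flat X
      S⊑X    : S ⊑ X
      rank-S : r S ≡ j
      rank-X : r X ≡ j
      corank : m + j ≡ rk M

    rS≡rX : r S ≡ r X
    rS≡rX = trans rank-S (sym rank-X)

  module _ {S X : Subset n} {j m : ℕ} (pos : Position S X j m) where
    open Position pos

    gain-inside : ∀ {e} → lookup X e ≡ true → gain S e ≡ 0
    gain-inside e∈X rewrite rank-stays-inside S⊑X rS≡rX e∈X = n∸n≡0 (r S)

    gain-outside : ∀ {e} → lookup X e ≡ false → gain S e ≡ 1
    gain-outside e∉X rewrite rank-jumps-outside flat S⊑X rS≡rX e∉X = m+n∸n≡m 1 (r S)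

    position-inside : ∀ {e} → lookup X e ≡ true → Position (S ∪ ⁅ e ⁆) X j m
    position-inside {e} e∈X = record
      { flat   = flat
      ; S⊑X    = p∪⁅x⁆⊑q {p = S} {q = X} {x = e} S⊑X e∈X
      ; rank-S = trans (rank-stays-inside S⊑X rS≡rX e∈X) rank-S
      ; rank-X = rank-X
      ; corank = corank
      }

    full-of-corank-zero : m ≡ 0 → X ≡ Eset
    full-of-corank-zero refl = flat-of-full-rank flat (trans rank-X corank)

    corank-zero-of-full : S ≡ Eset → m ≡ 0
    corank-zero-of-full refl = +-cancelʳ-≡ j m 0 (trans corank rank-S)

  position-outside : ∀ {S X j m e} → Position S X j (suc m) → lookup X e ≡ false →
    Position (S ∪ ⁅ e ⁆) (closure (X ∪ ⁅ e ⁆)) (suc j) m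
  position-outside {S} {X} {j} {m} {e} pos e∉X = record
    { flat   = flat-closure (X ∪ ⁅ e ⁆)
    ; S⊑X    = λ x x∈ → ⊑-closure (X ∪ ⁅ e ⁆) x (∪⁅⁆-mono {p = S} {q = X} e S⊑X x x∈)
    ; rank-S = trans (rank-jumps-outside flat S⊑X rS≡rX e∉X) (cong suc rank-S)
    ; rank-X = trans (rank-closure (X ∪ ⁅ e ⁆))
                 (trans (rank-jumps-outside flat (λ _ x → x) refl e∉X) (cong suc rank-X))
    ; corank = trans (+-suc m j) corank
    }
    where open Position pos

  ordersInside : Subset n → Subset n → ℕ → List ℕ → ℕ
  ordersInside S X k s = ∑[ e ← allFin n ] (⟦ lookup X e ∧ not (lookup S e) ⟧ * orders (S ∪ ⁅ e ⁆) k s)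

  ordersOutside : Subset n → Subset n → ℕ → List ℕ → ℕ
  ordersOutside S X k s = ∑[ e ← allFin n ] (⟦ not (lookup X e) ⟧ * orders (S ∪ ⁅ e ⁆) k s)

  orders-split : ∀ {S X j m} → Position S X j m → ∀ k b s →
    orders S (suc k) (b ∷ s)
      ≡ ⟦ does (0 ℕ.≟ b) ⟧ * ordersInside S X k s + ⟦ does (1 ℕ.≟ b) ⟧ * ordersOutside S X k s
  orders-split {S} {X} pos k b s = begin
    orders S (suc k) (b ∷ s)
      ≡⟨ orders-suc-∷ S k b s ⟩
    ∑[ e ← allFin n ] (⟦ not (lookup S e) ⟧ * (⟦ does (gain S e ℕ.≟ b) ⟧ * orders (S ∪ ⁅ e ⁆) k s))
      ≡⟨ ∑-cong (allFin n) by-position ⟩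
    ∑[ e ← allFin n ] (⟦ does (0 ℕ.≟ b) ⟧ * (⟦ lookup X e ∧ not (lookup S e) ⟧ * orders (S ∪ ⁅ e ⁆) k s)
                     + ⟦ does (1 ℕ.≟ b) ⟧ * (⟦ not (lookup X e) ⟧ * orders (S ∪ ⁅ e ⁆) k s))
      ≡⟨ ∑-distrib-+ (allFin n) _ _ ⟩
    ∑[ e ← allFin n ] (⟦ does (0 ℕ.≟ b) ⟧ * (⟦ lookup X e ∧ not (lookup S e) ⟧ * orders (S ∪ ⁅ e ⁆) k s))
    + ∑[ e ← allFin n ] (⟦ does (1 ℕ.≟ b) ⟧ * (⟦ not (lookup X e) ⟧ * orders (S ∪ ⁅ e ⁆) k s))
      ≡⟨ cong₂ _+_ (∑-*ˡ (allFin n) ⟦ does (0 ℕ.≟ b) ⟧ _) (∑-*ˡ (allFin n) ⟦ does (1 ℕ.≟ b) ⟧ _) ⟩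
    ⟦ does (0 ℕ.≟ b) ⟧ * ordersInside S X k s + ⟦ does (1 ℕ.≟ b) ⟧ * ordersOutside S X k s ∎
    where
    open ≡-Reasoning
    open Position pos
    by-position : ∀ e → ⟦ not (lookup S e) ⟧ * (⟦ does (gain S e ℕ.≟ b) ⟧ * orders (S ∪ ⁅ e ⁆) k s)
      ≡ ⟦ does (0 ℕ.≟ b) ⟧ * (⟦ lookup X e ∧ not (lookup S e) ⟧ * orders (S ∪ ⁅ e ⁆) k s)
        + ⟦ does (1 ℕ.≟ b) ⟧ * (⟦ not (lookup X e) ⟧ * orders (S ∪ ⁅ e ⁆) k s)
    by-position e with lookup S e in e∈S | lookup X e in e∈X
    ... | true  | false = ⊥-elim (false≢true (trans (sym e∈X) (S⊑X e e∈S)))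
    ... | true  | true  rewrite *-zeroʳ ⟦ does (0 ℕ.≟ b) ⟧ | *-zeroʳ ⟦ does (1 ℕ.≟ b) ⟧ = refl
    ... | false | true  rewrite gain-inside pos e∈X | *-zeroʳ ⟦ does (1 ℕ.≟ b) ⟧ =
      trans (*-left-comm 1 ⟦ does (0 ℕ.≟ b) ⟧ _) (sym (+-identityʳ _))
    ... | false | false rewrite gain-outside pos e∈X | *-zeroʳ ⟦ does (0 ℕ.≟ b) ⟧ =
      *-left-comm 1 ⟦ does (1 ℕ.≟ b) ⟧ _

  isFlagFromᵇ-head : ∀ {Y i} → (isFlatᵇ M Y ∧ (r Y ≡ᵇ i)) ≡ false →
    ∀ {m} (Zs : Vec (Subset n) m) → isFlagFromᵇ M i (Y ∷ Zs) ≡ false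
  isFlagFromᵇ-head head []       = head
  isFlagFromᵇ-head {Y} {i} head (Z ∷ Zs) with isFlatᵇ M Y | r Y ≡ᵇ i
  ... | false | _     = refl
  ... | true  | false = refl

  flagArrangements-vanish : ∀ {Y j} → (isFlatᵇ M Y ∧ (r Y ≡ᵇ j)) ≡ false →
    ∀ m t s → flagArrangements Y j m t s ≡ 0
  flagArrangements-vanish {Y} {j} head m t s = trans
    (∑-cong (vecsOf (allSubsets n) m) λ Zs →
      cong (λ b → ⟦ b ⟧ * arrangements t (compFrom M Y (toList Zs)) s) (isFlagFromᵇ-head head Zs))
    (∑-zero (vecsOf (allSubsets n) m))

  flagArrangements-0∷ : ∀ X j m t s → flagArrangements X j m t (0 ∷ s) ≡ t * flagArrangements X j m (t ∸ 1) s
  flagArrangements-0∷ X j m t s = trans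
    (∑-cong (vecsOf (allSubsets n) m) (λ Ys → *-left-comm ⟦ isFlagFromᵇ M j (X ∷ Ys) ⟧ t _))
    (∑-*ˡ (vecsOf (allSubsets n) m) t _)

  flagArrangements-1∷ : ∀ {X j} → Flat X → r X ≡ j → ∀ m t s →
    flagArrangements X j (suc m) t (1 ∷ s)
      ≡ ∑[ Y ← allSubsets n ]
          ((⟦ strictSubᵇ M X Y ⟧ * ∣ Y ─ X ∣) * flagArrangements Y (suc j) m (∣ Y ─ X ∣ + t ∸ 1) s)
  flagArrangements-1∷ {X} {j} flat rX≡j m t s = trans (∑-vecsOf-suc (allSubsets n) m _)
    (∑-cong (allSubsets n) λ Y → trans (∑-cong (vecsOf (allSubsets n) m) (next-step Y))
                                        (∑-*ˡ (vecsOf (allSubsets n) m) (⟦ strictSubᵇ M X Y ⟧ * ∣ Y ─ X ∣) _))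
    where
    next-step : ∀ Y Zs →
      ⟦ isFlagFromᵇ M j (X ∷ Y ∷ Zs) ⟧ * arrangements t (compFrom M X (toList (Y ∷ Zs))) (1 ∷ s)
      ≡ (⟦ strictSubᵇ M X Y ⟧ * ∣ Y ─ X ∣)
        * (⟦ isFlagFromᵇ M (suc j) (Y ∷ Zs) ⟧
           * arrangements (∣ Y ─ X ∣ + t ∸ 1) (compFrom M Y (toList Zs)) s)
    next-step Y Zs rewrite Flat⇒isFlatᵇ X flat | ≡-≡ᵇ rX≡j =
      trans (cong (_* _) (⟦∧⟧ (strictSubᵇ M X Y) _)) (*-interchange ⟦ strictSubᵇ M X Y ⟧ _ ∣ Y ─ X ∣ _)

  closure-preimage : ∀ {X Y} → Flat X → Flat Y → r Y ≡ suc (r X) →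
    ∑[ e ← allFin n ] (⟦ not (lookup X e) ⟧ * ⟦ does (closure (X ∪ ⁅ e ⁆) ≟ˢ Y) ⟧)
      ≡ ⟦ strictSubᵇ M X Y ⟧ * ∣ Y ─ X ∣
  closure-preimage {X} {Y} flatX flatY rY≡1+rX with subsetᵇ M X Y in X⊆ᵇY
  ... | true  = begin
    ∑[ e ← allFin n ] (⟦ not (lookup X e) ⟧ * ⟦ does (closure (X ∪ ⁅ e ⁆) ≟ˢ Y) ⟧)
      ≡⟨ ∑-cong (allFin n) hits ⟩
    ∑[ e ← allFin n ] ⟦ lookup Y e ∧ not (lookup X e) ⟧
      ≡⟨ sym (∣─∣≡∑ Y X) ⟩
    ∣ Y ─ X ∣
      ≡⟨ sym (+-identityʳ _) ⟩
    ⟦ not false ⟧ * ∣ Y ─ X ∣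
      ≡⟨ cong (λ b → ⟦ not b ⟧ * ∣ Y ─ X ∣) (sym (dec-false (X ≟ˢ Y) λ { refl → 1+n≢n (sym rY≡1+rX) })) ⟩
    ⟦ not (does (X ≟ˢ Y)) ⟧ * ∣ Y ─ X ∣
      ∎
    where
    open ≡-Reasoning
    X⊑Y = subsetᵇ⇒⊑ X Y X⊆ᵇY
    hits : ∀ e → ⟦ not (lookup X e) ⟧ * ⟦ does (closure (X ∪ ⁅ e ⁆) ≟ˢ Y) ⟧
               ≡ ⟦ lookup Y e ∧ not (lookup X e) ⟧
    hits e with lookup X e in e∈X | lookup Y e in e∈Y
    ... | true  | _     = sym (cong ⟦_⟧ (BP.∧-zeroʳ _))
    ... | false | true  rewrite closure-unique flatY (p∪⁅x⁆⊑q {p = X} {q = Y} {x = e} X⊑Y e∈Y)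
                                  (trans (rank-jumps-outside flatX (λ _ x → x) refl e∈X) (sym rY≡1+rX))
                              | ≟-refl _≟ˢ_ Y = refl
    ... | false | false = cong (λ b → 1 * ⟦ b ⟧) (dec-false (closure (X ∪ ⁅ e ⁆) ≟ˢ Y) λ { refl →
            false≢true (trans (sym e∈Y) (⊑-closure (X ∪ ⁅ e ⁆) e (x∈p∪⁅x⁆ X e))) })
  ... | false = trans (∑-cong (allFin n) misses) (∑-zero (allFin n))
    where
    misses : ∀ e → ⟦ not (lookup X e) ⟧ * ⟦ does (closure (X ∪ ⁅ e ⁆) ≟ˢ Y) ⟧ ≡ 0
    misses e with lookup X e
    ... | true  = refl
    ... | false = cong (λ b → 1 * ⟦ b ⟧) (dec-false (closure (X ∪ ⁅ e ⁆) ≟ˢ Y) λ { refl →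
            false≢true (trans (sym X⊆ᵇY) (⊑⇒subsetᵇ X (closure (X ∪ ⁅ e ⁆))
              λ x x∈X → ⊑-closure (X ∪ ⁅ e ⁆) x (p⊑p∪q X ⁅ e ⁆ x x∈X))) })

  flagArrangements-corank-zero : ∀ {X j} → Flat X → r X ≡ j →
    ∀ t s → flagArrangements X j 0 t s ≡ arrangements t [] s
  flagArrangements-corank-zero {X} flat rX≡j t s rewrite Flat⇒isFlatᵇ X flat | ≡-≡ᵇ rX≡j =
    trans (+-identityʳ _) (*-identityˡ _)

  free : Subset n → ℕ
  free S = ∣ Eset ─ S ∣

  free-∪⁅⁆ : ∀ {S e} → lookup S e ≡ false → free S ≡ suc (free (S ∪ ⁅ e ⁆))
  free-∪⁅⁆ {S} {e} e∉S = ∣─∣-remove Eset S e (lookup-⊤ e) e∉S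

  full-of-free-zero : ∀ {S} → free S ≡ 0 → S ≡ Eset
  full-of-free-zero {S} none = ≡-by-lookup S Eset full
    where
    full : ∀ e → lookup S e ≡ lookup Eset e
    full e with ∑-zero-inv (allFin n) _ (trans (sym (∣─∣≡∑ Eset S)) none) (∈-allFin e)
    ... | e-absent rewrite lookup-⊤ e with lookup S e
    ... | true = refl

  OrdersMatchFlags : ℕ → List ℕ → Set
  OrdersMatchFlags k s = ∀ {S X j m} → Position S X j m → k ≡ free S →
    orders S k s ≡ flagArrangements X j m ∣ X ─ S ∣ s

  orders-match-flags-0∷ : ∀ {k s} → OrdersMatchFlags k s → OrdersMatchFlags (suc k) (0 ∷ s)
  orders-match-flags-0∷ {k} {s} IH {S} {X} {j} {m} pos 1+k≡ = begin
    orders S (suc k) (0 ∷ s)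
      ≡⟨ trans (orders-split pos k 0 s) (trans (+-identityʳ _) (*-identityˡ _)) ⟩
    ordersInside S X k s
      ≡⟨ ∑-cong (allFin n) inside ⟩
    ∑[ e ← allFin n ] (⟦ lookup X e ∧ not (lookup S e) ⟧ * flagArrangements X j m (t ∸ 1) s)
      ≡⟨ ∑-*ʳ (allFin n) (flagArrangements X j m (t ∸ 1) s) _ ⟩
    ∑[ e ← allFin n ] ⟦ lookup X e ∧ not (lookup S e) ⟧ * flagArrangements X j m (t ∸ 1) s
      ≡⟨ cong (_* flagArrangements X j m (t ∸ 1) s) (sym (∣─∣≡∑ X S)) ⟩
    t * flagArrangements X j m (t ∸ 1) s
      ≡⟨ sym (flagArrangements-0∷ X j m t s) ⟩
    flagArrangements X j m t (0 ∷ s) ∎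
    where
    open ≡-Reasoning
    t = ∣ X ─ S ∣
    inside : ∀ e → ⟦ lookup X e ∧ not (lookup S e) ⟧ * orders (S ∪ ⁅ e ⁆) k s
                 ≡ ⟦ lookup X e ∧ not (lookup S e) ⟧ * flagArrangements X j m (t ∸ 1) s
    inside e with lookup X e in e∈X | lookup S e in e∈S
    ... | false | _     = refl
    ... | true  | true  = refl
    ... | true  | false = cong (1 *_) (trans
      (IH (position-inside pos e∈X) (suc-injective (trans 1+k≡ (free-∪⁅⁆ e∈S))))
      (cong (λ t′ → flagArrangements X j m (t′ ∸ 1) s) (sym (∣─∣-remove X S e e∈X e∈S))))

  orders-match-flags-1∷ : ∀ {k s} → OrdersMatchFlags k s → ∀ {S X j m} → Position S X j (suc m) → suc k ≡ free S →
    orders S (suc k) (1 ∷ s) ≡ flagArrangements X j (suc m) ∣ X ─ S ∣ (1 ∷ s)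
  orders-match-flags-1∷ {k} {s} IH {S} {X} {j} {m} pos 1+k≡ = begin
    orders S (suc k) (1 ∷ s)
      ≡⟨ trans (orders-split pos k 1 s) (*-identityˡ _) ⟩
    ordersOutside S X k s
      ≡⟨ ∑-cong (allFin n) outside ⟩
    ∑[ e ← allFin n ] (⟦ not (lookup X e) ⟧ * next (closure (X ∪ ⁅ e ⁆)))
      ≡⟨ ∑-fibres _≟ˢ_ (allSubsets n) (enumerates-allSubsets n) (allFin n)
                  (λ e → closure (X ∪ ⁅ e ⁆)) (λ e → ⟦ not (lookup X e) ⟧) next ⟩
    ∑[ Y ← allSubsets n ]
      (next Y * ∑[ e ← allFin n ] (⟦ not (lookup X e) ⟧ * ⟦ does (closure (X ∪ ⁅ e ⁆) ≟ˢ Y) ⟧))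
      ≡⟨ ∑-cong (allSubsets n) preimage ⟩
    ∑[ Y ← allSubsets n ] ((⟦ strictSubᵇ M X Y ⟧ * ∣ Y ─ X ∣) * next Y)
      ≡⟨ sym (flagArrangements-1∷ flat rank-X m t s) ⟩
    flagArrangements X j (suc m) t (1 ∷ s) ∎
    where
    open ≡-Reasoning
    open Position pos
    t = ∣ X ─ S ∣
    next : Subset n → ℕ
    next Y = flagArrangements Y (suc j) m (∣ Y ─ X ∣ + t ∸ 1) s
    outside : ∀ e → ⟦ not (lookup X e) ⟧ * orders (S ∪ ⁅ e ⁆) k s
                  ≡ ⟦ not (lookup X e) ⟧ * next (closure (X ∪ ⁅ e ⁆))
    outside e with lookup X e in e∈X
    ... | true  = refl
    ... | false = cong (1 *_) (trans
      (IH (position-outside pos e∈X) (suc-injective (trans 1+k≡ (free-∪⁅⁆ e∉S))))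
      (cong (λ t′ → flagArrangements Y (suc j) m t′ s) remaining))
      where
      Y = closure (X ∪ ⁅ e ⁆)
      e∉S : lookup S e ≡ false
      e∉S with lookup S e in e∈S
      ... | false = refl
      ... | true  = ⊥-elim (false≢true (trans (sym e∈X) (S⊑X e e∈S)))
      X⊑Y : X ⊑ Y
      X⊑Y x x∈X = ⊑-closure (X ∪ ⁅ e ⁆) x (p⊑p∪q X ⁅ e ⁆ x x∈X)
      remaining : ∣ Y ─ (S ∪ ⁅ e ⁆) ∣ ≡ ∣ Y ─ X ∣ + t ∸ 1
      remaining = cong (_∸ 1) (trans
        (sym (∣─∣-remove Y S e (⊑-closure (X ∪ ⁅ e ⁆) e (x∈p∪⁅x⁆ X e)) e∉S))
        (∣─∣-split {p = S} {q = X} {r = Y} S⊑X X⊑Y))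
    preimage : ∀ Y → next Y * ∑[ e ← allFin n ] (⟦ not (lookup X e) ⟧ * ⟦ does (closure (X ∪ ⁅ e ⁆) ≟ˢ Y) ⟧)
                   ≡ (⟦ strictSubᵇ M X Y ⟧ * ∣ Y ─ X ∣) * next Y
    preimage Y with isFlatᵇ M Y in Y-flat | r Y ≡ᵇ suc j in Y-rank
    ... | true  | true  = trans (*-comm (next Y) _)
      (cong (_* next Y) (closure-preimage flat (isFlatᵇ⇒Flat Y Y-flat)
                                            (trans (≡ᵇ-≡ Y-rank) (cong suc (sym rank-X)))))
    ... | true  | false
      rewrite flagArrangements-vanish {Y} {suc j} (cong₂ _∧_ Y-flat Y-rank) m (∣ Y ─ X ∣ + t ∸ 1) s =
      sym (*-zeroʳ (⟦ strictSubᵇ M X Y ⟧ * ∣ Y ─ X ∣))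
    ... | false | _
      rewrite flagArrangements-vanish {Y} {suc j} (cong (_∧ (r Y ≡ᵇ suc j)) Y-flat) m (∣ Y ─ X ∣ + t ∸ 1) s =
      sym (*-zeroʳ (⟦ strictSubᵇ M X Y ⟧ * ∣ Y ─ X ∣))

  orders-match-flags-zero : ∀ s → OrdersMatchFlags 0 s
  orders-match-flags-zero s {S} {X} {j} {m} pos 0≡free with full-of-free-zero {S} (sym 0≡free)
  ... | refl with corank-zero-of-full pos refl
  ... | refl = begin
    orders Eset 0 s
      ≡⟨ nothing-left s ⟩
    arrangements 0 [] s
      ≡⟨ cong (λ t → arrangements t [] s) (sym (trans (cong ∣_∣ (p─⊤≡⊥ X)) (∣⊥∣≡0 n))) ⟩
    arrangements (∣ X ─ Eset ∣) [] s
      ≡⟨ sym (flagArrangements-corank-zero flat rank-X (∣ X ─ Eset ∣) s) ⟩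
    flagArrangements X j 0 (∣ X ─ Eset ∣) s ∎
    where
    open ≡-Reasoning
    open Position pos
    nothing-left : ∀ s → orders Eset 0 s ≡ arrangements 0 [] s
    nothing-left []      = refl
    nothing-left (b ∷ s) = sym (arrangements-empty-flat b s)

  orders-match-flags : ∀ s k → OrdersMatchFlags k s
  orders-match-flags s                 zero    = orders-match-flags-zero s
  orders-match-flags []                (suc k) {S} {X} {j} {zero}  pos 1+k≡ = begin
    orders S (suc k) []
      ≡⟨ orders-suc-[] S k ⟩
    arrangements (suc k) [] []
      ≡⟨ cong (λ t → arrangements t [] []) (trans 1+k≡ (cong (λ Y → ∣ Y ─ S ∣) (sym (full-of-corank-zero pos refl)))) ⟩
    arrangements (∣ X ─ S ∣) [] []
      ≡⟨ sym (flagArrangements-corank-zero flat rank-X (∣ X ─ S ∣) []) ⟩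
    flagArrangements X j 0 (∣ X ─ S ∣) [] ∎
    where
    open ≡-Reasoning
    open Position pos
  orders-match-flags []                (suc k) {S} {X} {j} {suc m} pos 1+k≡ = trans (orders-suc-[] S k) (sym
    (trans (∑-cong (vecsOf (allSubsets n) (suc m)) (λ { (Y ∷ Zs) → *-zeroʳ ⟦ isFlagFromᵇ M j (X ∷ Y ∷ Zs) ⟧ }))
           (∑-zero (vecsOf (allSubsets n) (suc m)))))
  orders-match-flags (0 ∷ s)           (suc k) = orders-match-flags-0∷ (orders-match-flags s k)
  orders-match-flags (1 ∷ s)           (suc k) {S} {X} {j} {zero}  pos 1+k≡ = begin
    orders S (suc k) (1 ∷ s)
      ≡⟨ trans (orders-split pos k 1 s) (*-identityˡ _) ⟩
    ordersOutside S X k s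
      ≡⟨ trans (∑-cong (allFin n) nowhere-outside) (∑-zero (allFin n)) ⟩
    0
      ≡⟨ sym (flagArrangements-corank-zero flat rank-X (∣ X ─ S ∣) (1 ∷ s)) ⟩
    flagArrangements X j 0 (∣ X ─ S ∣) (1 ∷ s) ∎
    where
    open ≡-Reasoning
    open Position pos
    nowhere-outside : ∀ e → ⟦ not (lookup X e) ⟧ * orders (S ∪ ⁅ e ⁆) k s ≡ 0
    nowhere-outside e rewrite full-of-corank-zero pos refl | lookup-⊤ {n} e = refl
  orders-match-flags (1 ∷ s)           (suc k) {m = suc m} = orders-match-flags-1∷ (orders-match-flags s k)
  orders-match-flags (suc (suc b) ∷ s) (suc k) {S} {X} {j} {m} pos 1+k≡ = trans (orders-split pos k (suc (suc b)) s) (sym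
    (trans (∑-cong (vecsOf (allSubsets n) m) (λ Ys → *-zeroʳ ⟦ isFlagFromᵇ M j (X ∷ Ys) ⟧))
           (∑-zero (vecsOf (allSubsets n) m))))

  open Unique (Fin._≟_ {n}) using (Unique; unique?)

  distinctOutside⁻ : ∀ S l → distinctOutsideᵇ S l ≡ true → Unique l × All (λ e → lookup S e ≡ false) l
  distinctOutside⁻ S []       _ = [] , []
  distinctOutside⁻ S (e ∷ l) ok with lookup S e in e∉S
  ... | false with distinctOutside⁻ (S ∪ ⁅ e ⁆) l ok
  ...   | unique , outside =
    All.map (∉-∪⁅⁆-≢ {p = S}) outside ∷ unique , e∉S ∷ All.map (∉-∪⁅⁆ {p = S} {x = e}) outside

  distinctOutside⁺ : ∀ S l → Unique l → All (λ e → lookup S e ≡ false) l → distinctOutsideᵇ S l ≡ true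
  distinctOutside⁺ S []      _                   _                 = refl
  distinctOutside⁺ S (e ∷ l) (e∉l ∷ unique) (e∉S ∷ outside) rewrite e∉S =
    distinctOutside⁺ (S ∪ ⁅ e ⁆) l unique
      (All.zipWith (λ (e≢f , f∉S) → ∉-∪⁅⁆⁺ {p = S} e≢f f∉S) (e∉l , outside))

  unique≡distinctOutside∅ : ∀ l → does (unique? l) ≡ distinctOutsideᵇ ∅ l
  unique≡distinctOutside∅ l with unique? l
  ... | yes unique = sym (distinctOutside⁺ ∅ l unique (All.tabulate λ {e} _ → lookup-∅ e))
  ... | no ¬unique with distinctOutsideᵇ ∅ l in ok
  ...   | false = refl
  ...   | true  = ⊥-elim (¬unique (proj₁ (distinctOutside⁻ ∅ l ok)))

  Gcoeff≡orders : ∀ s → Gcoeff M s ≡ orders ∅ n s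
  Gcoeff≡orders s = trans (count≡∑ _ (vecsOf (allFin n) n)) (∑-cong (vecsOf (allFin n) n) λ π →
    trans (⟦∧⟧ (isPermᵇ π) _)
          (cong (λ b → ⟦ b ⟧ * ⟦ does (rankSeq M (toList π) ≟ℓ s) ⟧) (unique≡distinctOutside∅ (toList π))))

  flagSum : List ℕ → ℕ
  flagSum s = ∑[ F ← vecsOf (allSubsets n) (suc (rk M)) ] (⟦ isFlagᵇ M F ⟧ * compositionWeight (comp M F) s)

  flagSum≡flagArrangements : ∀ s → flagSum s ≡ flagArrangements (closure ∅) 0 (rk M) (∣ closure ∅ ─ ∅ ∣) s
  flagSum≡flagArrangements s = begin
    flagSum s
      ≡⟨ ∑-vecsOf-suc (allSubsets n) (rk M) _ ⟩
    ∑[ X ← allSubsets n ] flagArrangements X 0 (rk M) (∣ X ─ ∅ ∣) s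
      ≡⟨ ∑-cong (allSubsets n) only-closure-∅ ⟩
    ∑[ X ← allSubsets n ] (⟦ does (X ≟ˢ closure ∅) ⟧ * flagArrangements X 0 (rk M) (∣ X ─ ∅ ∣) s)
      ≡⟨ ∑-δ _≟ˢ_ (allSubsets n) (enumerates-allSubsets n) (closure ∅)
             (λ X → flagArrangements X 0 (rk M) (∣ X ─ ∅ ∣) s) ⟩
    flagArrangements (closure ∅) 0 (rk M) (∣ closure ∅ ─ ∅ ∣) s ∎
    where
    open ≡-Reasoning
    only-closure-∅ : ∀ X → flagArrangements X 0 (rk M) (∣ X ─ ∅ ∣) s
                         ≡ ⟦ does (X ≟ˢ closure ∅) ⟧ * flagArrangements X 0 (rk M) (∣ X ─ ∅ ∣) s
    only-closure-∅ X with X ≟ˢ closure ∅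
    ... | yes _ = sym (+-identityʳ _)
    ... | no X≢cl∅ with isFlatᵇ M X in X-flat | r X ≡ᵇ 0 in X-rank
    ...   | true  | true  = ⊥-elim (X≢cl∅ (sym (closure-unique (isFlatᵇ⇒Flat X X-flat) (∅⊑ X)
                                                 (trans rank-∅ (sym (≡ᵇ-≡ X-rank))))))
    ...   | true  | false = flagArrangements-vanish (cong₂ _∧_ X-flat X-rank) (rk M) _ s
    ...   | false | _     = flagArrangements-vanish (cong (_∧ (r X ≡ᵇ 0)) X-flat) (rk M) _ s

  Gcoeff≡flagSum : ∀ s → Gcoeff M s ≡ flagSum s
  Gcoeff≡flagSum s = begin
    Gcoeff M s
      ≡⟨ Gcoeff≡orders s ⟩
    orders ∅ n s
      ≡⟨ orders-match-flags s n start (sym (trans (cong ∣_∣ (p─⊥≡p (Eset {n}))) (∣⊤∣≡n n))) ⟩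
    flagArrangements (closure ∅) 0 (rk M) (∣ closure ∅ ─ ∅ ∣) s
      ≡⟨ sym (flagSum≡flagArrangements s) ⟩
    flagSum s ∎
    where
    open ≡-Reasoning
    start : Position ∅ (closure ∅) 0 (rk M)
    start = record
      { flat   = flat-closure ∅
      ; S⊑X    = ∅⊑ (closure ∅)
      ; rank-S = rank-∅
      ; rank-X = trans (rank-closure ∅) rank-∅
      ; corank = +-identityʳ (rk M)
      }

flagCompositions : ∀ {n} → Matroid n → List (List ℕ)
flagCompositions {n} M = map (comp M) (filter (T? ∘ isFlagᵇ M) (vecsOf (allSubsets n) (suc (rk M))))

Gcoeff≡∑-flagCompositions : ∀ {n} (M : Matroid n) s →
  Gcoeff M s ≡ ∑[ c ← flagCompositions M ] compositionWeight c s
Gcoeff≡∑-flagCompositions {n} M s = trans (Counting.Gcoeff≡flagSum M s)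
  (sym (∑-map-filter (isFlagᵇ M) (comp M) (vecsOf (allSubsets n) (suc (rk M))) (λ c → compositionWeight c s)))

∑-compMult : ∀ {n d} (M : Matroid n) (p : List (Subset n) → Fin d) c →
  ∑[ i ← allFin d ] compMult M p i c ≡ multiplicity _≟ℓ_ c (flagCompositions M)
∑-compMult {n} {d} M p c = begin
  ∑[ i ← allFin d ] compMult M p i c
    ≡⟨ ∑-cong (allFin d) (λ i → count≡∑ _ flags) ⟩
  ∑[ i ← allFin d ] ∑[ F ← flags ] ⟦ isFlagᵇ M F ∧ (does (block F Fin.≟ i) ∧ ofComp F) ⟧
    ≡⟨ ∑-comm (allFin d) flags _ ⟩
  ∑[ F ← flags ] ∑[ i ← allFin d ] ⟦ isFlagᵇ M F ∧ (does (block F Fin.≟ i) ∧ ofComp F) ⟧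
    ≡⟨ ∑-cong flags one-block ⟩
  ∑[ F ← flags ] (⟦ isFlagᵇ M F ⟧ * ⟦ ofComp F ⟧)
    ≡⟨ sym (∑-map-filter (isFlagᵇ M) (comp M) flags (λ c′ → ⟦ does (c′ ≟ℓ c) ⟧)) ⟩
  multiplicity _≟ℓ_ c (flagCompositions M) ∎
  where
  open ≡-Reasoning
  flags : List (Vec (Subset n) (suc (rk M)))
  flags = vecsOf (allSubsets n) (suc (rk M))
  block : Vec (Subset n) (suc (rk M)) → Fin d
  block F = p (redChain M F)
  ofComp : Vec (Subset n) (suc (rk M)) → Bool
  ofComp F = does (comp M F ≟ℓ c)
  one-block : ∀ F → ∑[ i ← allFin d ] ⟦ isFlagᵇ M F ∧ (does (block F Fin.≟ i) ∧ ofComp F) ⟧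
                  ≡ ⟦ isFlagᵇ M F ⟧ * ⟦ ofComp F ⟧
  one-block F = trans (∑-cong (allFin d) factor) (∑-δ Fin._≟_ (allFin d) (enumerates-allFin d) (block F) _)
    where
    factor : ∀ i → ⟦ isFlagᵇ M F ∧ (does (block F Fin.≟ i) ∧ ofComp F) ⟧
                 ≡ ⟦ does (i Fin.≟ block F) ⟧ * (⟦ isFlagᵇ M F ⟧ * ⟦ ofComp F ⟧)
    factor i = begin
      ⟦ isFlagᵇ M F ∧ (does (block F Fin.≟ i) ∧ ofComp F) ⟧
        ≡⟨ trans (⟦∧⟧ (isFlagᵇ M F) _) (cong (⟦ isFlagᵇ M F ⟧ *_) (⟦∧⟧ (does (block F Fin.≟ i)) _)) ⟩
      ⟦ isFlagᵇ M F ⟧ * (⟦ does (block F Fin.≟ i) ⟧ * ⟦ ofComp F ⟧)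
        ≡⟨ *-left-comm ⟦ isFlagᵇ M F ⟧ ⟦ does (block F Fin.≟ i) ⟧ ⟦ ofComp F ⟧ ⟩
      ⟦ does (block F Fin.≟ i) ⟧ * (⟦ isFlagᵇ M F ⟧ * ⟦ ofComp F ⟧)
        ≡⟨ cong (λ b → ⟦ b ⟧ * _) (≟-sym Fin._≟_ (block F) i) ⟩
      ⟦ does (i Fin.≟ block F) ⟧ * (⟦ isFlagᵇ M F ⟧ * ⟦ ofComp F ⟧) ∎

theorem3p3 : {n m : ℕ} (M : Matroid n) (N : Matroid m) →
    NoLoopsNoColoops M → NoLoopsNoColoops N →
    (d : ℕ) (p : List (Subset n) → Fin d) (q : List (Subset m) → Fin d) →
    (∀ i → ∃ λ C → IsChain M C × p C ≡ i) →
    (∀ i → ∃ λ C → IsChain N C × q C ≡ i) →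
    (∀ i c → compMult M p i c ≡ compMult N q i c) →
    ∀ s → Gcoeff M s ≡ Gcoeff N s
theorem3p3 M N _ _ d p q _ _ same-blocks s = begin
  Gcoeff M s
    ≡⟨ Gcoeff≡∑-flagCompositions M s ⟩
  ∑[ c ← flagCompositions M ] compositionWeight c s
    ≡⟨ ∑-cong-multiplicity _≟ℓ_ (flagCompositions M) (flagCompositions N) _ same-compositions ⟩
  ∑[ c ← flagCompositions N ] compositionWeight c s
    ≡⟨ sym (Gcoeff≡∑-flagCompositions N s) ⟩
  Gcoeff N s ∎
  where
  open ≡-Reasoning
  same-compositions : ∀ c → multiplicity _≟ℓ_ c (flagCompositions M) ≡ multiplicity _≟ℓ_ c (flagCompositions N)
  same-compositions c = begin
    multiplicity _≟ℓ_ c (flagCompositions M) ≡⟨ sym (∑-compMult M p c) ⟩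
    ∑[ i ← allFin d ] compMult M p i c       ≡⟨ ∑-cong (allFin d) (λ i → same-blocks i c) ⟩
    ∑[ i ← allFin d ] compMult N q i c       ≡⟨ ∑-compMult N q c ⟩
    multiplicity _≟ℓ_ c (flagCompositions N) ∎
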